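{- Let $L$ be an intermediate logic with the disjunction property. If an m-rule $\Gamma/\Delta$ is admissible for $L$, then so is the rule $\bigwedge_{A\in\Gamma}A\,/\,\bigvee_{B\in\Delta}B$.
   Context: Formulas are built from a countable set of propositional variables using $\land,\lor,\to,\neg,\bot,\top$; an empty conjunction is $\top$ and an empty disjunction is $\bot$. An intermediate logic is a set $L$ of formulas with $\mathrm{Int}\subseteq L\subsetneq$ (all formulas), closed under modus ponens and substitution. $L$ has the disjunction property if $A\lor B\in L$ implies $A\in L$ or $B\in L$. An m-rule is a pair of finite sets of formulas $\Gamma/\Delta$; it is admissible for $L$ if for every substitution $\sigma$, $\sigma(\Gamma)\subseteq L$ implies $\sigma(\Delta)\cap L\ne\emptyset$. -}

module Defs where

open import Data.Nat using (ℕ)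
open import Data.List using (List; []; _∷_; map; foldr)
open import Data.List.Membership.Propositional using (_∈_)
open import Data.List.Relation.Unary.All using (All)
open import Data.List.Relation.Unary.Any using (Any)
open import Data.Product using (Σ; _×_; ∃)
open import Data.Sum using (_⊎_)
open import Relation.Nullary using (¬_)
open import Level using (0ℓ; suc)

infixr 6 _∧_
infixr 5 _∨_
infixr 4 _⇒_
data Fm : Set where
  var : ℕ → Fm
  _∧_ _∨_ _⇒_ : Fm → Fm → Fm
  ¬′_ : Fm → Fm
  ⊥′ ⊤′ : Fm

Subst : Set
Subst = ℕ → Fm

sub : Subst → Fm → Fm
sub σ (var n) = σ n
sub σ (A ∧ B) = sub σ A ∧ sub σ B
sub σ (A ∨ B) = sub σ A ∨ sub σ B
sub σ (A ⇒ B) = sub σ A ⇒ sub σ B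
sub σ (¬′ A) = ¬′ sub σ A
sub σ ⊥′ = ⊥′
sub σ ⊤′ = ⊤′

⋀ : List Fm → Fm
⋀ = foldr _∧_ ⊤′

⋁ : List Fm → Fm
⋁ = foldr _∨_ ⊥′

data Int : Fm → Set where
  k    : ∀ {A B} → Int (A ⇒ B ⇒ A)
  s    : ∀ {A B C} → Int ((A ⇒ B ⇒ C) ⇒ (A ⇒ B) ⇒ A ⇒ C)
  ∧i   : ∀ {A B} → Int (A ⇒ B ⇒ A ∧ B)
  ∧e₁  : ∀ {A B} → Int (A ∧ B ⇒ A)
  ∧e₂  : ∀ {A B} → Int (A ∧ B ⇒ B)
  ∨i₁  : ∀ {A B} → Int (A ⇒ A ∨ B)
  ∨i₂  : ∀ {A B} → Int (B ⇒ A ∨ B)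
  ∨e   : ∀ {A B C} → Int ((A ⇒ C) ⇒ (B ⇒ C) ⇒ A ∨ B ⇒ C)
  ⊥e   : ∀ {A} → Int (⊥′ ⇒ A)
  ⊤i   : Int ⊤′
  ¬i   : ∀ {A} → Int ((A ⇒ ⊥′) ⇒ ¬′ A)
  ¬e   : ∀ {A} → Int (¬′ A ⇒ A ⇒ ⊥′)
  mp   : ∀ {A B} → Int (A ⇒ B) → Int A → Int B

FmSet : Set₁
FmSet = Fm → Set

record IntermediateLogic (L : FmSet) : Set where
  field
    int⊆   : ∀ {A} → Int A → L A
    proper : Σ Fm (λ A → ¬ L A)
    closMP : ∀ {A B} → L (A ⇒ B) → L A → L B
    closSub : ∀ (σ : Subst) {A} → L A → L (sub σ A)

DisjunctionProperty : FmSet → Set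
DisjunctionProperty L = ∀ A B → L (A ∨ B) → L A ⊎ L B

-- m-rules Γ/Δ with Γ, Δ finite sets of formulas (represented as lists).
record MRule : Set where
  constructor _/_
  field
    prem : List Fm
    conc : List Fm

Admissible : FmSet → MRule → Set
Admissible L (Γ / Δ) =
  ∀ (σ : Subst) → All (λ A → L (sub σ A)) Γ → Any (λ B → L (sub σ B)) Δ

module Submission where

open import Data.List using (List; []; _∷_; map)
open import Data.List.Relation.Unary.All using (All; []; _∷_)
open import Data.List.Relation.Unary.Any using (Any; here; there)
import Data.List.Relation.Unary.All.Properties as All
import Data.List.Relation.Unary.Any.Properties as Any
open import Relation.Binary.PropositionalEquality using (_≡_; refl; cong; subst; sym)
open import Defs

-- Substitution commutes with ⋀ and ⋁, and in any set containing Int and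
-- closed under modus ponens, ⋀ Γ yields every member of Γ while any member
-- of Δ yields ⋁ Δ; so σ(⋀ Γ) ∈ L gives σ(Γ) ⊆ L, admissibility gives some
-- σ(B) ∈ L with B ∈ Δ, hence σ(⋁ Δ) ∈ L.

sub-⋀ : (σ : Subst) (Γ : List Fm) → sub σ (⋀ Γ) ≡ ⋀ (map (sub σ) Γ)
sub-⋀ σ []      = refl
sub-⋀ σ (A ∷ Γ) = cong (sub σ A ∧_) (sub-⋀ σ Γ)

sub-⋁ : (σ : Subst) (Δ : List Fm) → sub σ (⋁ Δ) ≡ ⋁ (map (sub σ) Δ)
sub-⋁ σ []      = refl
sub-⋁ σ (B ∷ Δ) = cong (sub σ B ∨_) (sub-⋁ σ Δ)

module _ (L : FmSet)
         (int⊆ : ∀ {A} → Int A → L A)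
         (closMP : ∀ {A B} → L (A ⇒ B) → L A → L B) where

  ⋀⇒All : (Γ : List Fm) → L (⋀ Γ) → All L Γ
  ⋀⇒All []      _ = []
  ⋀⇒All (A ∷ Γ) p = closMP (int⊆ ∧e₁) p ∷ ⋀⇒All Γ (closMP (int⊆ ∧e₂) p)

  Any⇒⋁ : (Δ : List Fm) → Any L Δ → L (⋁ Δ)
  Any⇒⋁ (B ∷ Δ) (here p)  = closMP (int⊆ ∨i₁) p
  Any⇒⋁ (B ∷ Δ) (there q) = closMP (int⊆ ∨i₂) (Any⇒⋁ Δ q)

mainTheorem6 : (L : FmSet) → IntermediateLogic L → DisjunctionProperty L →
    (Γ Δ : List Fm) → Admissible L (Γ / Δ) →
    Admissible L ((⋀ Γ ∷ []) / (⋁ Δ ∷ []))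
mainTheorem6 L IL _ Γ Δ adm σ (σ⋀Γ ∷ []) = here (subst L (sym (sub-⋁ σ Δ)) σ⋁Δ)
  where
  open IntermediateLogic IL

  σΓ : All (λ A → L (sub σ A)) Γ
  σΓ = All.map⁻ (⋀⇒All L int⊆ closMP (map (sub σ) Γ) (subst L (sub-⋀ σ Γ) σ⋀Γ))

  σ⋁Δ : L (⋁ (map (sub σ) Δ))
  σ⋁Δ = Any⇒⋁ L int⊆ closMP (map (sub σ) Δ) (Any.map⁺ (adm σ σΓ))
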